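{- Let $(M,\eta,\mu)$ be a monad on $\mathbf{Sets}$, $A$ a set of labels, $O$ a set, $a\colon MO\to O$ an Eilenberg–Moore $M$-algebra, and $c=\langle o,t\rangle\colon X\to O\times(MX)^A$. Let $[\![\cdot]\!]\colon MX\to O^{A^*}$ be the semantic map of $c$ with respect to $a$. (1) (Transitions) Let $(\hat M,\hat\eta,\hat\mu)$ be a monad, $\sigma\colon M\Rightarrow\hat M$ a monad map, and $\hat a\colon\hat MO\to O$ an $\hat M$-algebra with $a=\hat a\circ\sigma_O$. Let $\hat c=\langle o,\sigma_X^A\circ t\rangle\colon X\to O\times(\hat MX)^A$ and let $\widehat{[\![\cdot]\!]}\colon\hat MX\to O^{A^*}$ be its semantic map with respect to $\hat a$. Then $[\![\cdot]\!]\circ\eta_X=\widehat{[\![\cdot]\!]}\circ\hat\eta_X$. (2) (Observations) Let $\hat a\colon M\hat O\to\hat O$ be an $M$-algebra and $h\colon(O,a)\to(\hat O,\hat a)$ an $M$-algebra homomorphism. Let $\hat c=\langle h\circ o,t\rangle\colon X\to\hat O\times(MX)^A$ and $\widehat{[\![\cdot]\!]}\colon MX\to\hat O^{A^*}$ its semantic map with respect to $\hat a$. Then $\widehat{[\![\cdot]\!]}=h^{A^*}\circ[\![\cdot]\!]$, where $h^{A^*}(\varphi)=h\circ\varphi$.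
   Context: An Eilenberg–Moore algebra for a monad $(M,\eta,\mu)$ is a map $a\colon MO\to O$ with $a\circ\eta_O=\mathrm{id}_O$ and $a\circ Ma=a\circ\mu_O$; a homomorphism $h\colon(O,a)\to(\hat O,\hat a)$ is a map with $h\circ a=\hat a\circ Mh$. A monad map $\sigma\colon M\Rightarrow\hat M$ is a natural transformation with $\sigma\circ\eta=\hat\eta$ and $\sigma\circ\mu=\hat\mu\circ\hat M\sigma\circ\sigma_M$. Given $c=\langle o,t\rangle\colon X\to O\times(MX)^A$ and an $M$-algebra $a\colon MO\to O$, the determinisation is $\langle o^\sharp,t^\sharp\rangle\colon MX\to O\times(MX)^A$ with $o^\sharp=a\circ Mo$ and $t^\sharp(m)(\ell)=\mu_X\big(M(\mathrm{ev}_\ell\circ t)(m)\big)$ for $\ell\in A$, where $\mathrm{ev}_\ell(g)=g(\ell)$. The semantic map $[\![\cdot]\!]\colon MX\to O^{A^*}$ is defined by $[\![m]\!](\varepsilon)=o^\sharp(m)$ and $[\![m]\!](\ell w)=[\![t^\sharp(m)(\ell)]\!](w)$ for $\ell\in A$, $w\in A^*$. -}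

module Defs where

open import Data.List using (List; []; _∷_)
open import Data.Product using (_×_; _,_; proj₁; proj₂)
open import Function using (_∘_; id)
open import Relation.Binary.PropositionalEquality using (_≡_)

-- A monad on Sets (Set₀), given by functor action, unit and multiplication.
-- Equalities of maps are stated pointwise (no function extensionality).
record Monad : Set₁ where
  field
    M     : Set → Set
    fmap  : {X Y : Set} → (X → Y) → M X → M Y
    η     : {X : Set} → X → M X
    μ     : {X : Set} → M (M X) → M X
    fmap-id   : {X : Set} (m : M X) → fmap id m ≡ m
    fmap-∘    : {X Y Z : Set} (g : Y → Z) (f : X → Y) (m : M X) →
                fmap (g ∘ f) m ≡ fmap g (fmap f m)
    η-natural : {X Y : Set} (f : X → Y) (x : X) → fmap f (η x) ≡ η (f x)
    μ-natural : {X Y : Set} (f : X → Y) (m : M (M X)) →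
                fmap f (μ m) ≡ μ (fmap (fmap f) m)
    μ-η       : {X : Set} (m : M X) → μ (η m) ≡ m
    μ-fmapη   : {X : Set} (m : M X) → μ (fmap η m) ≡ m
    μ-assoc   : {X : Set} (m : M (M (M X))) → μ (fmap μ m) ≡ μ (μ m)

record IsEMAlgebra (T : Monad) (O : Set) (a : Monad.M T O → O) : Set where
  open Monad T
  field
    unit : (x : O) → a (η x) ≡ x
    mult : (m : M (M O)) → a (fmap a m) ≡ a (μ m)

IsAlgHom : (T : Monad) {O Ô : Set} → (Monad.M T O → O) → (Monad.M T Ô → Ô) → (O → Ô) → Set
IsAlgHom T {O} a â h = (m : Monad.M T O) → h (a m) ≡ â (Monad.fmap T h m)

record IsMonadMap (T T̂ : Monad) (σ : {X : Set} → Monad.M T X → Monad.M T̂ X) : Set₁ where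
  private
    module T = Monad T
    module T̂ = Monad T̂
  field
    natural : {X Y : Set} (f : X → Y) (m : T.M X) → σ (T.fmap f m) ≡ T̂.fmap f (σ m)
    unit    : {X : Set} (x : X) → σ (T.η x) ≡ T̂.η x
    mult    : {X : Set} (m : T.M (T.M X)) → σ (T.μ m) ≡ T̂.μ (T̂.fmap σ (σ m))

module _ (T : Monad) {A O X : Set} (a : Monad.M T O → O) (o : X → O) (t : X → A → Monad.M T X) where
  open Monad T

  o♯ : M X → O
  o♯ m = a (fmap o m)

  t♯ : M X → A → M X
  t♯ m ℓ = μ (fmap (λ x → t x ℓ) m)

  ⟦_⟧ : M X → List A → O
  ⟦ m ⟧ []      = o♯ m
  ⟦ m ⟧ (ℓ ∷ w) = ⟦ t♯ m ℓ ⟧ w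

-- A monad map σ
-- commutes with t♯ (by naturality and compatibility with μ) and turns o♯ into ô♯
-- when a = â ∘ σ, so ⟦ m ⟧ = ⟦̂ σ m ⟧ for every m, and σ ∘ η = η̂ gives (1).
-- An algebra homomorphism h leaves t♯ unchanged and turns o♯ into h ∘ o♯, so (2)
-- follows by induction on the word.  Neither part uses the Eilenberg–Moore laws.
module Submission where

open import Defs
open import Data.List using (List; []; _∷_)
open import Data.Product using (_×_; _,_)
open import Function using (_∘′_)
open import Relation.Binary.PropositionalEquality using (_≡_; sym; trans; cong; module ≡-Reasoning)
open ≡-Reasoning

module _ (T T̂ : Monad) (σ : {Y : Set} → Monad.M T Y → Monad.M T̂ Y) (isMonadMap : IsMonadMap T T̂ σ)
         {A O X : Set} (a : Monad.M T O → O) (â : Monad.M T̂ O → O)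
         (a≡â∘σ : (m : Monad.M T O) → a m ≡ â (σ m))
         (o : X → O) (t : X → A → Monad.M T X) where
  private
    module T = Monad T
    module T̂ = Monad T̂
    open IsMonadMap isMonadMap

  t̂ : X → A → T̂.M X
  t̂ x ℓ = σ (t x ℓ)

  o♯-monadMap : (m : T.M X) → o♯ T a o t m ≡ o♯ T̂ â o t̂ (σ m)
  o♯-monadMap m = begin
    a (T.fmap o m)     ≡⟨ a≡â∘σ (T.fmap o m) ⟩
    â (σ (T.fmap o m)) ≡⟨ cong â (natural o m) ⟩
    â (T̂.fmap o (σ m)) ∎

  t♯-monadMap : (m : T.M X) (ℓ : A) → σ (t♯ T a o t m ℓ) ≡ t♯ T̂ â o t̂ (σ m) ℓ
  t♯-monadMap m ℓ = begin
    σ (T.μ (T.fmap tℓ m))                ≡⟨ mult (T.fmap tℓ m) ⟩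
    T̂.μ (T̂.fmap σ (σ (T.fmap tℓ m)))     ≡⟨ cong (T̂.μ ∘′ T̂.fmap σ) (natural tℓ m) ⟩
    T̂.μ (T̂.fmap σ (T̂.fmap tℓ (σ m)))     ≡⟨ cong T̂.μ (sym (T̂.fmap-∘ σ tℓ (σ m))) ⟩
    T̂.μ (T̂.fmap (λ x → t̂ x ℓ) (σ m))    ∎
    where
    tℓ : X → T.M X
    tℓ x = t x ℓ

  ⟦⟧-monadMap : (m : T.M X) (w : List A) → ⟦_⟧ T a o t m w ≡ ⟦_⟧ T̂ â o t̂ (σ m) w
  ⟦⟧-monadMap m []      = o♯-monadMap m
  ⟦⟧-monadMap m (ℓ ∷ w) = trans (⟦⟧-monadMap (t♯ T a o t m ℓ) w)
                                (cong (λ n → ⟦_⟧ T̂ â o t̂ n w) (t♯-monadMap m ℓ))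

  ⟦⟧-η-monadMap : (x : X) (w : List A) → ⟦_⟧ T a o t (T.η x) w ≡ ⟦_⟧ T̂ â o t̂ (T̂.η x) w
  ⟦⟧-η-monadMap x w = trans (⟦⟧-monadMap (T.η x) w) (cong (λ n → ⟦_⟧ T̂ â o t̂ n w) (unit x))

module _ (T : Monad) {A O Ô X : Set} (a : Monad.M T O → O) (â : Monad.M T Ô → Ô)
         (h : O → Ô) (isAlgHom : IsAlgHom T a â h)
         (o : X → O) (t : X → A → Monad.M T X) where
  private
    module T = Monad T

  o♯-algHom : (m : T.M X) → o♯ T â (λ x → h (o x)) t m ≡ h (o♯ T a o t m)
  o♯-algHom m = begin
    â (T.fmap (λ x → h (o x)) m) ≡⟨ cong â (T.fmap-∘ h o m) ⟩
    â (T.fmap h (T.fmap o m))    ≡⟨ sym (isAlgHom (T.fmap o m)) ⟩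
    h (a (T.fmap o m))           ∎

  ⟦⟧-algHom : (m : T.M X) (w : List A) → ⟦_⟧ T â (λ x → h (o x)) t m w ≡ h (⟦_⟧ T a o t m w)
  ⟦⟧-algHom m []      = o♯-algHom m
  ⟦⟧-algHom m (ℓ ∷ w) = ⟦⟧-algHom (t♯ T a o t m ℓ) w

theorem6p7 : (T : Monad) (A O X : Set) (a : Monad.M T O → O) → IsEMAlgebra T O a →
    (o : X → O) (t : X → A → Monad.M T X) →
    ((T̂ : Monad) (σ : {Y : Set} → Monad.M T Y → Monad.M T̂ Y) → IsMonadMap T T̂ σ →
    (â : Monad.M T̂ O → O) → IsEMAlgebra T̂ O â →
    ((m : Monad.M T O) → a m ≡ â (σ m)) →
    (x : X) (w : List A) →
    ⟦_⟧ T a o t (Monad.η T x) w ≡ ⟦_⟧ T̂ â o (λ y ℓ → σ (t y ℓ)) (Monad.η T̂ x) w)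
    ×
    ((Ô : Set) (â : Monad.M T Ô → Ô) → IsEMAlgebra T Ô â →
    (h : O → Ô) → IsAlgHom T a â h →
    (m : Monad.M T X) (w : List A) →
    ⟦_⟧ T â (λ y → h (o y)) t m w ≡ h (⟦_⟧ T a o t m w))
theorem6p7 T A O X a _ o t =
  (λ T̂ σ isMonadMap â _ a≡â∘σ → ⟦⟧-η-monadMap T T̂ σ isMonadMap a â a≡â∘σ o t) ,
  (λ Ô â _ h isAlgHom → ⟦⟧-algHom T a â h isAlgHom o t)
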